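{- Let $A$ be an alphabet with $q\geq 2$ letters, and for $n\geq 1$ let $M_q(n)=q^{ -n}\sum_{w\in A^n}P(w)$, where $P(w)$ is the number of distinct nonempty palindromes occurring as factors of $w$. Then $$\limsup_{n\to\infty}\frac{M_q(n)}{n}\leq\frac{2}{q-1}.$$
   Context: $A^n$ is the set of words of length $n$ over $A$. A word is a palindrome if it equals its reversal; a factor is a block of consecutive letters of a word. -}

module Defs where

open import Data.Nat using (ℕ; zero; suc)
open import Data.Fin using (Fin)
import Data.Fin.Properties as FinP
open import Data.List using (List; []; _∷_; [_]; _++_; map; concatMap; reverse; filter; deduplicate; length; allFin)
open import Data.Nat.ListAction using (sum)
open import Data.List.Properties using (≡-dec)
open import Relation.Binary.PropositionalEquality using (_≡_)
open import Relation.Nullary using (Dec)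

Word : ℕ → Set
Word q = List (Fin q)

allWords : (q n : ℕ) → List (Word q)
allWords q zero = [] ∷ []
allWords q (suc n) = concatMap (λ w → map (λ a → a ∷ w) (allFin q)) (allWords q n)

prefixes⁺ : ∀ {q} → Word q → List (Word q)
prefixes⁺ [] = []
prefixes⁺ (x ∷ xs) = [ x ] ∷ map (x ∷_) (prefixes⁺ xs)

-- All nonempty factors (with multiplicity, by position).
factors⁺ : ∀ {q} → Word q → List (Word q)
factors⁺ [] = []
factors⁺ (x ∷ xs) = prefixes⁺ (x ∷ xs) ++ factors⁺ xs

IsPalindrome : ∀ {q} → Word q → Set
IsPalindrome w = reverse w ≡ w

palindrome? : ∀ {q} (w : Word q) → Dec (IsPalindrome w)
palindrome? w = ≡-dec FinP._≟_ (reverse w) w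

P : ∀ {q} → Word q → ℕ
P w = length (deduplicate (≡-dec FinP._≟_) (filter palindrome? (factors⁺ w)))

-- S q n = ∑_{w ∈ A^n} P(w), so that M_q(n) = S q n / q^n.
S : ℕ → ℕ → ℕ
S q n = sum (map P (allWords q n))

module Submission where

-- Write p = q - 1 and, for a word w, Lc(w) (factorLongPals) for the number of
-- occurrences, counted by position, of palindromic factors of length ≥ 3 in w.
--
--  * Distinct palindromes of length ≤ 2 are the q letters and the q squares aa, so
--    P(w) ≤ 2q + Lc(w), and summing over A^n gives S(n) ≤ 2q·q^n + T(n), where T(n)
--    (factorTotal) is the sum of Lc over A^n.
--  * Splitting off the first letter, T(n+1) = R(n+1) + q·T(n), where R(n) (prefixTotal)
--    sums over A^n the number of long palindromic prefixes; splitting off the last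
--    letter, R(n+1) = q·R(n) + LPal(n+1), where LPal(m) ≤ Pal(m) count the long and
--    all palindromes of length m.  Peeling the two border letters off a palindrome
--    gives Pal(m+2) ≤ q·Pal(m).
--  * These combine into the invariant p·R(n) + Pal(n) + Pal(n+1) ≤ 2q^n (n ≥ 2), so
--    p·R(n) ≤ 2q^n and, by the recurrence for T, p·T(n) ≤ 2n·q^n.
--  * Hence S(n)·k·p ≤ q^n·n·(2k + p) as soon as n ≥ 2qk, which is the theorem.

open import Defs
open import Data.Nat using (ℕ; zero; suc; _+_; _*_; _∸_; _^_; _≤_; _<_; z≤n; s≤s)
open import Data.Nat.Properties
open import Data.Nat.ListAction using (sum)
open import Data.Nat.Tactic.RingSolver using (solve-∀)
open import Data.Product using (∃-syntax; _,_; _×_)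
open import Data.Sum using (inj₁; inj₂)
open import Data.Fin using (Fin) renaming (zero to fzero; suc to fsuc)
import Data.Fin.Properties as FinP
open import Data.List
  using (List; []; _∷_; [_]; _++_; map; concatMap; reverse; filter; deduplicate; length; allFin; tabulate; _∷ʳ_)
open import Data.List.Properties
  using (map-++; map-tabulate; length-tabulate; length-++; length-map; length-filter; filter-++;
         filter-reject; ∷-injective; ∷ʳ-injective; unfold-reverse; reverse-++; ≡-dec)
open import Data.List.Relation.Unary.All as All using (All; []; _∷_)
open import Data.List.Relation.Unary.Any using (here; there)
import Data.List.Relation.Unary.All.Properties as AllP
open import Data.List.Membership.Propositional using (_∈_)
open import Data.List.Membership.Propositional.Properties
  using (∈-∃++; ∈-++⁻; ∈-++⁺ˡ; ∈-++⁺ʳ; ∈-map⁺; ∈-allFin; ∈-filter⁻; ∈-filter⁺; ∈-deduplicate⁻)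
open import Data.List.Relation.Unary.Unique.Propositional using (Unique)
open import Data.List.Relation.Unary.AllPairs using (_∷_)
import Data.List.Relation.Unary.Unique.Propositional.Properties as UniqueP
import Data.List.Relation.Unary.Unique.DecPropositional.Properties as DecUniqueP
open import Data.Bool using (if_then_else_)
open import Function using (_∘_; id)
open import Relation.Binary.PropositionalEquality
  using (_≡_; refl; sym; trans; cong; cong₂; module ≡-Reasoning)
open import Relation.Nullary using (¬_; yes; no; does; ¬?; contradiction)
open import Relation.Unary using (Decidable)

∑ : {A : Set} → List A → (A → ℕ) → ℕ
∑ xs f = sum (map f xs)

syntax ∑ xs (λ x → e) = ∑[ x ∈ xs ] e

private
  variable
    A B : Set

∑-++ : (xs ys : List A) (f : A → ℕ) → ∑ (xs ++ ys) f ≡ ∑ xs f + ∑ ys f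
∑-++ [] ys f = refl
∑-++ (x ∷ xs) ys f = trans (cong (f x +_) (∑-++ xs ys f)) (sym (+-assoc (f x) _ _))

∑-cong : {f g : A → ℕ} → (∀ x → f x ≡ g x) → (xs : List A) → ∑ xs f ≡ ∑ xs g
∑-cong f≡g [] = refl
∑-cong f≡g (x ∷ xs) = cong₂ _+_ (f≡g x) (∑-cong f≡g xs)

∑-mono : {f g : A → ℕ} → (∀ x → f x ≤ g x) → (xs : List A) → ∑ xs f ≤ ∑ xs g
∑-mono f≤g [] = z≤n
∑-mono f≤g (x ∷ xs) = +-mono-≤ (f≤g x) (∑-mono f≤g xs)

∑-+ : (xs : List A) (f g : A → ℕ) → ∑[ x ∈ xs ] (f x + g x) ≡ ∑ xs f + ∑ xs g
∑-+ [] f g = refl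
∑-+ (x ∷ xs) f g = trans (cong (f x + g x +_) (∑-+ xs f g)) (interchange (f x) (g x) _ _)
  where
    interchange : ∀ a b c d → a + b + (c + d) ≡ a + c + (b + d)
    interchange = solve-∀

∑-*ˡ : (xs : List A) (c : ℕ) (f : A → ℕ) → ∑[ x ∈ xs ] (c * f x) ≡ c * ∑ xs f
∑-*ˡ [] c f = sym (*-zeroʳ c)
∑-*ˡ (x ∷ xs) c f = trans (cong (c * f x +_) (∑-*ˡ xs c f)) (sym (*-distribˡ-+ c (f x) _))

∑-const : (xs : List A) (c : ℕ) → ∑[ _ ∈ xs ] c ≡ length xs * c
∑-const [] c = refl
∑-const (x ∷ xs) c = cong (c +_) (∑-const xs c)

∑-zero : {f : A → ℕ} → (∀ x → f x ≡ 0) → (xs : List A) → ∑ xs f ≡ 0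
∑-zero f≡0 [] = refl
∑-zero f≡0 (x ∷ xs) = cong₂ _+_ (f≡0 x) (∑-zero f≡0 xs)

∑-swap : (xs : List A) (ys : List B) (f : A → B → ℕ) →
         ∑[ x ∈ xs ] ∑[ y ∈ ys ] f x y ≡ ∑[ y ∈ ys ] ∑[ x ∈ xs ] f x y
∑-swap [] ys f = sym (∑-zero (λ _ → refl) ys)
∑-swap (x ∷ xs) ys f =
  trans (cong (∑ ys (f x) +_) (∑-swap xs ys f)) (sym (∑-+ ys (f x) (λ y → ∑[ x ∈ xs ] f x y)))

∑-map : (h : B → A) (ys : List B) (f : A → ℕ) → ∑ (map h ys) f ≡ ∑ ys (f ∘ h)
∑-map h [] f = refl
∑-map h (y ∷ ys) f = cong (f (h y) +_) (∑-map h ys f)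

∑-concatMap : (g : B → List A) (ys : List B) (f : A → ℕ) →
              ∑ (concatMap g ys) f ≡ ∑[ y ∈ ys ] ∑ (g y) f
∑-concatMap g [] f = refl
∑-concatMap g (y ∷ ys) f =
  trans (∑-++ (g y) (concatMap g ys) f) (cong (∑ (g y) f +_) (∑-concatMap g ys f))

∑-letters-const : (q c : ℕ) → ∑[ _ ∈ allFin q ] c ≡ q * c
∑-letters-const q c = trans (∑-const (allFin q) c) (cong (_* c) (length-tabulate {n = q} id))

δ : {q : ℕ} → Fin q → Fin q → ℕ
δ a b = if does (a FinP.≟ b) then 1 else 0

δ-refl : {q : ℕ} (a : Fin q) → δ a a ≡ 1
δ-refl a with a FinP.≟ a
... | yes _ = refl
... | no a≢a = contradiction refl a≢a

∑-δ : (q : ℕ) (b : Fin q) → ∑[ a ∈ allFin q ] δ a b ≡ 1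
∑-δ (suc q) b = trans (cong (δ fzero b +_) (∑-tail (λ a → δ a b))) (head+tail b)
  where
    -- allFin (suc q) is fzero followed by the successors of allFin q.
    ∑-tail : (f : Fin (suc q) → ℕ) → sum (map f (tabulate fsuc)) ≡ ∑ (allFin q) (f ∘ fsuc)
    ∑-tail f = cong sum (trans (map-tabulate fsuc f) (sym (map-tabulate id (f ∘ fsuc))))
    head+tail : (b : Fin (suc q)) → δ fzero b + ∑[ a ∈ allFin q ] δ (fsuc a) b ≡ 1
    head+tail fzero = cong suc (∑-zero (λ _ → refl) (allFin q))
    head+tail (fsuc b) = ∑-δ q b

module _ {q : ℕ} where

  ∑-cons : (n : ℕ) (f : Word q → ℕ) →
           ∑ (allWords q (suc n)) f ≡ ∑[ w ∈ allWords q n ] ∑[ a ∈ allFin q ] f (a ∷ w)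
  ∑-cons n f = trans (∑-concatMap (λ w → map (_∷ w) (allFin q)) (allWords q n) f)
                     (∑-cong (λ w → ∑-map (_∷ w) (allFin q) f) (allWords q n))

  ∑-snoc : (n : ℕ) (f : Word q → ℕ) →
           ∑ (allWords q (suc n)) f ≡ ∑[ u ∈ allWords q n ] ∑[ a ∈ allFin q ] f (u ∷ʳ a)
  ∑-snoc zero f = ∑-cons zero f
  ∑-snoc (suc n) f = begin
    ∑ (allWords q (2 + n)) f
      ≡⟨ ∑-cons (suc n) f ⟩
    ∑[ w ∈ allWords q (suc n) ] ∑[ a ∈ allFin q ] f (a ∷ w)
      ≡⟨ ∑-snoc n _ ⟩
    ∑[ v ∈ allWords q n ] ∑[ b ∈ allFin q ] ∑[ a ∈ allFin q ] f (a ∷ (v ∷ʳ b))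
      ≡⟨ ∑-cong (λ v → ∑-swap (allFin q) (allFin q) (λ b a → f (a ∷ (v ∷ʳ b)))) (allWords q n) ⟩
    ∑[ v ∈ allWords q n ] ∑[ a ∈ allFin q ] ∑[ b ∈ allFin q ] f (a ∷ (v ∷ʳ b))
      ≡⟨ ∑-cons n (λ u → ∑[ b ∈ allFin q ] f (u ∷ʳ b)) ⟨
    ∑[ u ∈ allWords q (suc n) ] ∑[ b ∈ allFin q ] f (u ∷ʳ b) ∎
    where open ≡-Reasoning

  ∑-words-const : (n c : ℕ) → ∑[ _ ∈ allWords q n ] c ≡ q ^ n * c
  ∑-words-const zero c = refl
  ∑-words-const (suc n) c = begin
    ∑[ _ ∈ allWords q (suc n) ] c       ≡⟨ ∑-cons n (λ _ → c) ⟩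
    ∑[ _ ∈ allWords q n ] ∑[ _ ∈ allFin q ] c
                                        ≡⟨ ∑-cong (λ _ → ∑-letters-const q c) (allWords q n) ⟩
    ∑[ _ ∈ allWords q n ] (q * c)       ≡⟨ ∑-words-const n (q * c) ⟩
    q ^ n * (q * c)                     ≡⟨ *-assoc (q ^ n) q c ⟨
    q ^ n * q * c                       ≡⟨ cong (_* c) (*-comm (q ^ n) q) ⟩
    q ^ suc n * c                       ∎
    where open ≡-Reasoning

  ∑-words-vanish : (n : ℕ) {f : Word q → ℕ} → (∀ w → length w ≡ n → f w ≡ 0) →
                   ∑ (allWords q n) f ≡ 0
  ∑-words-vanish zero f≡0 = cong (_+ 0) (f≡0 [] refl)
  ∑-words-vanish (suc n) {f} f≡0 = trans (∑-cons n f)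
    (∑-words-vanish n (λ w ∣w∣≡n → ∑-zero (λ a → f≡0 (a ∷ w) (cong suc ∣w∣≡n)) (allFin q)))

module _ {q : ℕ} where

  -- Palindromes of length ≤ 2 are handled separately; "long" means length ≥ 3.
  long? : Decidable (λ (u : Word q) → 2 < length u)
  long? u = 2 <? length u

  longPals : List (Word q) → ℕ
  longPals xs = length (filter long? (filter palindrome? xs))

  longPals-++ : (xs ys : List (Word q)) → longPals (xs ++ ys) ≡ longPals xs + longPals ys
  longPals-++ xs ys = begin
    length (filter long? (filter palindrome? (xs ++ ys)))
      ≡⟨ cong (length ∘ filter long?) (filter-++ palindrome? xs ys) ⟩
    length (filter long? (filter palindrome? xs ++ filter palindrome? ys))
      ≡⟨ cong length (filter-++ long? (filter palindrome? xs) (filter palindrome? ys)) ⟩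
    length (filter long? (filter palindrome? xs) ++ filter long? (filter palindrome? ys))
      ≡⟨ length-++ (filter long? (filter palindrome? xs)) ⟩
    longPals xs + longPals ys ∎
    where open ≡-Reasoning

  longPals-short : (xs : List (Word q)) → All (λ u → length u ≤ 2) xs → longPals xs ≡ 0
  longPals-short [] [] = refl
  longPals-short (x ∷ xs) (x≤2 ∷ xs≤2) with palindrome? x
  ... | no _ = longPals-short xs xs≤2
  ... | yes _ = trans (cong length (filter-reject long? {x} (≤⇒≯ x≤2))) (longPals-short xs xs≤2)

  isPal isLongPal : Word q → ℕ
  isPal u = length (filter palindrome? [ u ])
  isLongPal u = longPals [ u ]

  isPal≤1 : (u : Word q) → isPal u ≤ 1
  isPal≤1 u = length-filter palindrome? [ u ]

  isLongPal≤isPal : (u : Word q) → isLongPal u ≤ isPal u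
  isLongPal≤isPal u = length-filter long? (filter palindrome? [ u ])

  isPal-yes : (v : Word q) → IsPalindrome v → isPal v ≡ 1
  isPal-yes v pal-v with palindrome? v
  ... | yes _ = refl
  ... | no ¬pal-v = contradiction pal-v ¬pal-v

  palindrome-border : (a b : Fin q) (v : Word q) →
                      IsPalindrome (a ∷ (v ∷ʳ b)) → a ≡ b × IsPalindrome v
  palindrome-border a b v pal with ∷-injective (trans (sym reverse-avb) pal)
    where
      reverse-avb : reverse (a ∷ (v ∷ʳ b)) ≡ b ∷ (reverse v ∷ʳ a)
      reverse-avb = trans (unfold-reverse a (v ∷ʳ b)) (cong (_∷ʳ a) (reverse-++ v [ b ]))
  ... | refl , core with ∷ʳ-injective (reverse v) v core
  ... | pal-v , _ = refl , pal-v

  isPal-border : (a b : Fin q) (v : Word q) → isPal (a ∷ (v ∷ʳ b)) ≤ isPal v * δ a b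
  isPal-border a b v with palindrome? (a ∷ (v ∷ʳ b))
  ... | no _ = z≤n
  ... | yes pal with palindrome-border a b v pal
  ... | refl , pal-v rewrite isPal-yes v pal-v | δ-refl a = s≤s z≤n

  prefixLongPals factorLongPals : Word q → ℕ
  prefixLongPals u = longPals (prefixes⁺ u)
  factorLongPals w = longPals (factors⁺ w)

  prefixes⁺-∷ʳ : (u : Word q) (a : Fin q) → prefixes⁺ (u ∷ʳ a) ≡ prefixes⁺ u ++ [ u ∷ʳ a ]
  prefixes⁺-∷ʳ [] a = refl
  prefixes⁺-∷ʳ (x ∷ u) a =
    cong ([ x ] ∷_) (trans (cong (map (x ∷_)) (prefixes⁺-∷ʳ u a)) (map-++ (x ∷_) (prefixes⁺ u) _))

  prefixLongPals-∷ʳ : (u : Word q) (a : Fin q) →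
                      prefixLongPals (u ∷ʳ a) ≡ prefixLongPals u + isLongPal (u ∷ʳ a)
  prefixLongPals-∷ʳ u a =
    trans (cong longPals (prefixes⁺-∷ʳ u a)) (longPals-++ (prefixes⁺ u) [ u ∷ʳ a ])

  factorLongPals-∷ : (a : Fin q) (w : Word q) →
                     factorLongPals (a ∷ w) ≡ prefixLongPals (a ∷ w) + factorLongPals w
  factorLongPals-∷ a w = longPals-++ (prefixes⁺ (a ∷ w)) (factors⁺ w)

  prefixes⁺-shorter : (u : Word q) → All (λ v → length v ≤ length u) (prefixes⁺ u)
  prefixes⁺-shorter [] = []
  prefixes⁺-shorter (x ∷ u) =
    s≤s z≤n ∷ AllP.map⁺ (All.map s≤s (prefixes⁺-shorter u))

  prefixLongPals-short : (u : Word q) → length u ≤ 2 → prefixLongPals u ≡ 0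
  prefixLongPals-short u u≤2 =
    longPals-short (prefixes⁺ u) (All.map (λ v≤u → ≤-trans v≤u u≤2) (prefixes⁺-shorter u))

module _ (q : ℕ) where

  -- pal n: palindromes of length n; longPal n: long ones; prefixTotal n (R in the
  -- outline): long palindromic prefixes; factorTotal n (T): long palindromic factors.
  pal longPal prefixTotal factorTotal : ℕ → ℕ
  pal n = ∑ (allWords q n) isPal
  longPal n = ∑ (allWords q n) isLongPal
  prefixTotal n = ∑ (allWords q n) prefixLongPals
  factorTotal n = ∑ (allWords q n) factorLongPals

  pal≤ : (n : ℕ) → pal n ≤ q ^ n
  pal≤ n = begin
    pal n                        ≤⟨ ∑-mono isPal≤1 (allWords q n) ⟩
    ∑[ _ ∈ allWords q n ] 1      ≡⟨ ∑-words-const n 1 ⟩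
    q ^ n * 1                    ≡⟨ *-identityʳ (q ^ n) ⟩
    q ^ n                        ∎
    where open ≤-Reasoning

  longPal≤pal : (n : ℕ) → longPal n ≤ pal n
  longPal≤pal n = ∑-mono isLongPal≤isPal (allWords q n)

  -- A palindrome of length n+2 is a·v·a with v a palindrome of length n.
  pal-step : (n : ℕ) → pal (2 + n) ≤ q * pal n
  pal-step n = begin
    pal (2 + n)
      ≡⟨ ∑-cons (suc n) isPal ⟩
    ∑[ w ∈ allWords q (suc n) ] ∑[ a ∈ allFin q ] isPal (a ∷ w)
      ≡⟨ ∑-snoc n _ ⟩
    ∑[ v ∈ allWords q n ] ∑[ b ∈ allFin q ] ∑[ a ∈ allFin q ] isPal (a ∷ (v ∷ʳ b))
      ≤⟨ ∑-mono (λ v → ∑-mono (λ b → ∑-mono (λ a → isPal-border a b v) (allFin q)) (allFin q)) (allWords q n) ⟩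
    ∑[ v ∈ allWords q n ] ∑[ b ∈ allFin q ] ∑[ a ∈ allFin q ] (isPal v * δ a b)
      ≡⟨ ∑-cong (λ v → ∑-cong (λ b → ∑-*ˡ (allFin q) (isPal v) (λ a → δ a b)) (allFin q)) (allWords q n) ⟩
    ∑[ v ∈ allWords q n ] ∑[ b ∈ allFin q ] (isPal v * ∑[ a ∈ allFin q ] δ a b)
      ≡⟨ ∑-cong (λ v → ∑-cong (λ b → cong (isPal v *_) (∑-δ q b)) (allFin q)) (allWords q n) ⟩
    ∑[ v ∈ allWords q n ] ∑[ b ∈ allFin q ] (isPal v * 1)
      ≡⟨ ∑-cong (λ v → ∑-letters-const q (isPal v * 1)) (allWords q n) ⟩
    ∑[ v ∈ allWords q n ] (q * (isPal v * 1))
      ≡⟨ ∑-cong (λ v → cong (q *_) (*-identityʳ (isPal v))) (allWords q n) ⟩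
    ∑[ v ∈ allWords q n ] (q * isPal v)
      ≡⟨ ∑-*ˡ (allWords q n) q isPal ⟩
    q * pal n ∎
    where open ≤-Reasoning

  -- A long palindromic prefix of u·a is one of u, or u·a itself.
  prefixTotal-step : (n : ℕ) → prefixTotal (suc n) ≡ q * prefixTotal n + longPal (suc n)
  prefixTotal-step n = begin
    prefixTotal (suc n)
      ≡⟨ ∑-snoc n prefixLongPals ⟩
    ∑[ u ∈ allWords q n ] ∑[ a ∈ allFin q ] prefixLongPals (u ∷ʳ a)
      ≡⟨ ∑-cong (λ u → ∑-cong (prefixLongPals-∷ʳ u) (allFin q)) (allWords q n) ⟩
    ∑[ u ∈ allWords q n ] ∑[ a ∈ allFin q ] (prefixLongPals u + isLongPal (u ∷ʳ a))
      ≡⟨ ∑-cong (λ u → ∑-+ (allFin q) _ _) (allWords q n) ⟩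
    ∑[ u ∈ allWords q n ] (∑[ _ ∈ allFin q ] prefixLongPals u + ∑[ a ∈ allFin q ] isLongPal (u ∷ʳ a))
      ≡⟨ ∑-+ (allWords q n) _ _ ⟩
    ∑[ u ∈ allWords q n ] ∑[ _ ∈ allFin q ] prefixLongPals u
      + ∑[ u ∈ allWords q n ] ∑[ a ∈ allFin q ] isLongPal (u ∷ʳ a)
      ≡⟨ cong₂ _+_ (∑-cong (λ u → ∑-letters-const q (prefixLongPals u)) (allWords q n))
                   (sym (∑-snoc n isLongPal)) ⟩
    ∑[ u ∈ allWords q n ] (q * prefixLongPals u) + longPal (suc n)
      ≡⟨ cong (_+ longPal (suc n)) (∑-*ˡ (allWords q n) q prefixLongPals) ⟩
    q * prefixTotal n + longPal (suc n) ∎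
    where open ≡-Reasoning

  -- A long palindromic factor of a·w is a prefix of a·w or a factor of w.
  factorTotal-step : (n : ℕ) → factorTotal (suc n) ≡ prefixTotal (suc n) + q * factorTotal n
  factorTotal-step n = begin
    factorTotal (suc n)
      ≡⟨ ∑-cons n factorLongPals ⟩
    ∑[ w ∈ allWords q n ] ∑[ a ∈ allFin q ] factorLongPals (a ∷ w)
      ≡⟨ ∑-cong (λ w → ∑-cong (λ a → factorLongPals-∷ a w) (allFin q)) (allWords q n) ⟩
    ∑[ w ∈ allWords q n ] ∑[ a ∈ allFin q ] (prefixLongPals (a ∷ w) + factorLongPals w)
      ≡⟨ ∑-cong (λ w → ∑-+ (allFin q) _ _) (allWords q n) ⟩
    ∑[ w ∈ allWords q n ] (∑[ a ∈ allFin q ] prefixLongPals (a ∷ w) + ∑[ _ ∈ allFin q ] factorLongPals w)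
      ≡⟨ ∑-+ (allWords q n) _ _ ⟩
    ∑[ w ∈ allWords q n ] ∑[ a ∈ allFin q ] prefixLongPals (a ∷ w)
      + ∑[ w ∈ allWords q n ] ∑[ _ ∈ allFin q ] factorLongPals w
      ≡⟨ cong₂ _+_ (sym (∑-cons n prefixLongPals))
                   (∑-cong (λ w → ∑-letters-const q (factorLongPals w)) (allWords q n)) ⟩
    prefixTotal (suc n) + ∑[ w ∈ allWords q n ] (q * factorLongPals w)
      ≡⟨ cong (prefixTotal (suc n) +_) (∑-*ˡ (allWords q n) q factorLongPals) ⟩
    prefixTotal (suc n) + q * factorTotal n ∎
    where open ≡-Reasoning

  prefixTotal-small : (n : ℕ) → n ≤ 2 → prefixTotal n ≡ 0
  prefixTotal-small n n≤2 =
    ∑-words-vanish n (λ w ∣w∣≡n → prefixLongPals-short w (≤-trans (≤-reflexive ∣w∣≡n) n≤2))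

module _ (p : ℕ) where
  private
    q = suc p
    R = prefixTotal q
    T = factorTotal q

  -- The invariant p·R(n) + Pal(n) + Pal(n+1) ≤ 2q^n for n ≥ 2: it holds at n = 2
  -- since R(2) = 0, and by the recurrences for R and Pal the left side grows by at
  -- most a factor q from n to n + 1.
  invariant : (n : ℕ) → p * R (2 + n) + pal q (2 + n) + pal q (3 + n) ≤ 2 * q ^ (2 + n)
  invariant zero = begin
    p * R 2 + pal q 2 + pal q 3
      ≡⟨ cong (λ r → p * r + pal q 2 + pal q 3) (prefixTotal-small q 2 ≤-refl) ⟩
    p * 0 + pal q 2 + pal q 3
      ≤⟨ +-mono-≤ (+-monoʳ-≤ (p * 0) (pal≤ q 2)) (≤-trans (pal-step q 1) (*-monoʳ-≤ q (pal≤ q 1))) ⟩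
    p * 0 + q ^ 2 + q ^ 2
      ≡⟨ doubling p (q ^ 2) ⟩
    2 * q ^ 2 ∎
    where
      open ≤-Reasoning
      doubling : ∀ p x → p * 0 + x + x ≡ 2 * x
      doubling = solve-∀
  invariant (suc n) = begin
    p * R (3 + n) + pal q (3 + n) + pal q (4 + n)
      ≡⟨ cong (λ r → p * r + pal q (3 + n) + pal q (4 + n)) (prefixTotal-step q (2 + n)) ⟩
    p * (q * R (2 + n) + longPal q (3 + n)) + pal q (3 + n) + pal q (4 + n)
      ≤⟨ +-mono-≤ (+-monoˡ-≤ (pal q (3 + n)) (*-monoʳ-≤ p (+-monoʳ-≤ (q * R (2 + n)) (longPal≤pal q (3 + n)))))
                  (pal-step q (2 + n)) ⟩
    p * (q * R (2 + n) + pal q (3 + n)) + pal q (3 + n) + q * pal q (2 + n)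
      ≡⟨ regroup p (R (2 + n)) (pal q (3 + n)) (pal q (2 + n)) ⟩
    q * (p * R (2 + n) + pal q (2 + n) + pal q (3 + n))
      ≤⟨ *-monoʳ-≤ q (invariant n) ⟩
    q * (2 * q ^ (2 + n))
      ≡⟨ factor-q q (q ^ (2 + n)) ⟩
    2 * q ^ (3 + n) ∎
    where
      open ≤-Reasoning
      regroup : ∀ p r x y → p * (suc p * r + x) + x + suc p * y ≡ suc p * (p * r + y + x)
      regroup = solve-∀
      factor-q : ∀ q z → q * (2 * z) ≡ 2 * (q * z)
      factor-q = solve-∀

  prefixTotal-bound-short : (n : ℕ) → n ≤ 2 → p * R n ≤ 2 * q ^ n
  prefixTotal-bound-short n n≤2 =
    ≤-trans (≤-reflexive (trans (cong (p *_) (prefixTotal-small q n n≤2)) (*-zeroʳ p))) z≤n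

  prefixTotal-bound : (n : ℕ) → p * R n ≤ 2 * q ^ n
  prefixTotal-bound zero = prefixTotal-bound-short 0 z≤n
  prefixTotal-bound (suc zero) = prefixTotal-bound-short 1 (s≤s z≤n)
  prefixTotal-bound (suc (suc n)) = ≤-trans (≤-trans (m≤m+n _ _) (m≤m+n _ _)) (invariant n)

  -- Long palindromic factors: p·T(n) ≤ 2n·q^n, by T(n+1) = R(n+1) + q·T(n).
  factorTotal-bound : (n : ℕ) → p * T n ≤ 2 * n * q ^ n
  factorTotal-bound zero = ≤-reflexive (*-zeroʳ p)
  factorTotal-bound (suc n) = begin
    p * T (suc n)                          ≡⟨ cong (p *_) (factorTotal-step q n) ⟩
    p * (R (suc n) + q * T n)              ≡⟨ distrib p (R (suc n)) (T n) ⟩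
    p * R (suc n) + q * (p * T n)          ≤⟨ +-mono-≤ (prefixTotal-bound (suc n)) (*-monoʳ-≤ q (factorTotal-bound n)) ⟩
    2 * (q * q ^ n) + q * (2 * n * q ^ n)  ≡⟨ collect q n (q ^ n) ⟩
    2 * suc n * q ^ suc n                  ∎
    where
      open ≤-Reasoning
      distrib : ∀ p r t → p * (r + suc p * t) ≡ p * r + suc p * (p * t)
      distrib = solve-∀
      collect : ∀ q n z → 2 * (q * z) + q * (2 * n * z) ≡ 2 * suc n * (q * z)
      collect = solve-∀

unique-length-≤ : (xs ys : List A) → Unique xs → (∀ {z} → z ∈ xs → z ∈ ys) → length xs ≤ length ys
unique-length-≤ [] ys _ _ = z≤n
unique-length-≤ (x ∷ xs) ys (x∉xs ∷ unique-xs) xs⊆ys with ∈-∃++ (xs⊆ys (here refl))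
... | as , bs , refl = begin
    suc (length xs)               ≤⟨ s≤s (unique-length-≤ xs (as ++ bs) unique-xs xs⊆as++bs) ⟩
    suc (length (as ++ bs))       ≡⟨ cong suc (length-++ as) ⟩
    suc (length as + length bs)   ≡⟨ +-suc (length as) (length bs) ⟨
    length as + suc (length bs)   ≡⟨ length-++ as ⟨
    length (as ++ x ∷ bs)         ∎
  where
    open ≤-Reasoning
    -- Removing x from ys keeps the rest of xs, since x does not occur in xs.
    xs⊆as++bs : ∀ {z} → z ∈ xs → z ∈ as ++ bs
    xs⊆as++bs z∈xs with ∈-++⁻ as (xs⊆ys (there z∈xs))
    ... | inj₁ z∈as = ∈-++⁺ˡ z∈as
    ... | inj₂ (here refl) = contradiction refl (All.lookup x∉xs z∈xs)
    ... | inj₂ (there z∈bs) = ∈-++⁺ʳ as z∈bs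

length-split : {P : A → Set} (P? : Decidable P) (xs : List A) →
               length xs ≡ length (filter P? xs) + length (filter (¬? ∘ P?) xs)
length-split P? [] = refl
length-split P? (x ∷ xs) with P? x
... | yes _ = cong suc (length-split P? xs)
... | no _ = trans (cong suc (length-split P? xs)) (sym (+-suc _ _))

module _ {q : ℕ} where

  prefixes⁺-nonempty : (w : Word q) → All (λ z → 1 ≤ length z) (prefixes⁺ w)
  prefixes⁺-nonempty [] = []
  prefixes⁺-nonempty (x ∷ w) = s≤s z≤n ∷ AllP.map⁺ (All.universal (λ _ → s≤s z≤n) (prefixes⁺ w))

  factors⁺-nonempty : (w : Word q) → All (λ z → 1 ≤ length z) (factors⁺ w)
  factors⁺-nonempty [] = []
  factors⁺-nonempty (x ∷ w) = AllP.++⁺ (prefixes⁺-nonempty (x ∷ w)) (factors⁺-nonempty w)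

  shortPals : List (Word q)
  shortPals = map [_] (allFin q) ++ map (λ a → a ∷ a ∷ []) (allFin q)

  shortPals-length : length shortPals ≡ q + q
  shortPals-length = trans (length-++ (map [_] (allFin q)))
    (cong₂ _+_ (trans (length-map [_] (allFin q)) (length-tabulate {n = q} id))
               (trans (length-map _ (allFin q)) (length-tabulate {n = q} id)))

  short∈shortPals : (z : Word q) → 1 ≤ length z → ¬ (2 < length z) → IsPalindrome z → z ∈ shortPals
  short∈shortPals (a ∷ []) _ _ _ = ∈-++⁺ˡ (∈-map⁺ [_] (∈-allFin a))
  short∈shortPals (a ∷ b ∷ []) _ _ pal with ∷-injective pal
  ... | refl , _ = ∈-++⁺ʳ (map [_] (allFin q)) (∈-map⁺ (λ a → a ∷ a ∷ []) (∈-allFin a))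
  short∈shortPals (a ∷ b ∷ c ∷ z) _ not-long _ = contradiction (s≤s (s≤s (s≤s z≤n))) not-long

  -- Split the distinct palindromic factors by length: the long ones are among the
  -- long occurrences, the short ones among shortPals.
  P≤ : (w : Word q) → P w ≤ factorLongPals w + (q + q)
  P≤ w = begin
    P w                                                    ≡⟨ length-split long? distinct ⟩
    length (filter long? distinct) + length (filter (¬? ∘ long?) distinct)
      ≤⟨ +-mono-≤ (unique-length-≤ _ _ (UniqueP.filter⁺ long? distinct-unique) long⊆)
                  (unique-length-≤ _ _ (UniqueP.filter⁺ (¬? ∘ long?) distinct-unique) short⊆) ⟩
    factorLongPals w + length shortPals                    ≡⟨ cong (factorLongPals w +_) shortPals-length ⟩
    factorLongPals w + (q + q)                             ∎
    where
      open ≤-Reasoning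
      palFactors distinct : List (Word q)
      palFactors = filter palindrome? (factors⁺ w)
      distinct = deduplicate (≡-dec FinP._≟_) palFactors

      distinct-unique : Unique distinct
      distinct-unique = DecUniqueP.deduplicate-! (≡-dec FinP._≟_) palFactors

      ∈palFactors : ∀ {z} → z ∈ distinct → z ∈ palFactors
      ∈palFactors = ∈-deduplicate⁻ (≡-dec FinP._≟_) palFactors

      long⊆ : ∀ {z} → z ∈ filter long? distinct → z ∈ filter long? palFactors
      long⊆ z∈ with ∈-filter⁻ long? z∈
      ... | z∈distinct , long = ∈-filter⁺ long? (∈palFactors z∈distinct) long

      short⊆ : ∀ {z} → z ∈ filter (¬? ∘ long?) distinct → z ∈ shortPals
      short⊆ {z} z∈ with ∈-filter⁻ (¬? ∘ long?) z∈
      ... | z∈distinct , short with ∈-filter⁻ palindrome? (∈palFactors z∈distinct)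
      ... | z∈factors , pal = short∈shortPals z (All.lookup (factors⁺-nonempty w) z∈factors) short pal

S≤ : (q n : ℕ) → S q n ≤ factorTotal q n + q ^ n * (q + q)
S≤ q n = begin
  S q n                                                        ≤⟨ ∑-mono P≤ (allWords q n) ⟩
  ∑[ w ∈ allWords q n ] (factorLongPals w + (q + q))          ≡⟨ ∑-+ (allWords q n) factorLongPals _ ⟩
  factorTotal q n + ∑[ _ ∈ allWords q n ] (q + q)              ≡⟨ cong (factorTotal q n +_) (∑-words-const n (q + q)) ⟩
  factorTotal q n + q ^ n * (q + q)                            ∎
  where open ≤-Reasoning

clear-denominators : {s t z c n k p : ℕ} → s ≤ t + z * c → p * t ≤ 2 * n * z → c * k ≤ n →
                     s * k * p ≤ z * n * (2 * k + p)
clear-denominators {s} {t} {z} {c} {n} {k} {p} s≤ pt≤ ck≤n = begin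
  s * k * p                         ≤⟨ *-monoˡ-≤ p (*-monoˡ-≤ k s≤) ⟩
  (t + z * c) * k * p               ≡⟨ expand t z c k p ⟩
  k * (p * t) + z * p * (c * k)     ≤⟨ +-mono-≤ (*-monoʳ-≤ k pt≤) (*-monoʳ-≤ (z * p) ck≤n) ⟩
  k * (2 * n * z) + z * p * n       ≡⟨ collect k n z p ⟩
  z * n * (2 * k + p)               ∎
  where
    open ≤-Reasoning
    expand : ∀ t z c k p → (t + z * c) * k * p ≡ k * (p * t) + z * p * (c * k)
    expand = solve-∀
    collect : ∀ k n z p → k * (2 * n * z) + z * p * n ≡ z * n * (2 * k + p)
    collect = solve-∀

-- M_q(n)/n ≤ 2/(q-1) + 1/k for all n ≥ N = 2qk.
mainTheorem4 : (q : ℕ) → 2 ≤ q → (k : ℕ) → 1 ≤ k →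
    ∃[ N ] ((n : ℕ) → N ≤ n → 1 ≤ n →
      S q n * k * (q ∸ 1) ≤ (q ^ n) * n * (2 * k + (q ∸ 1)))
mainTheorem4 q@(suc p@(suc _)) (s≤s (s≤s z≤n)) k _ = (q + q) * k , λ n N≤n _ →
  clear-denominators (S≤ q n) (factorTotal-bound p n) N≤n
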